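{- Let $k\ge1$, $S=\{1,\dots,k\}$, and for each $i\in S$ let $D_i=\{A\subseteq S\mid i\in A\}$ and let $s_i\in\mathcal{P}(\wp(S),S)$ be the constant function with domain $D_i$ and value $i$. Then for every $p\in S$ and every choice function $\gamma$ with domain $D_p$ (that is, $\gamma:D_p\to S$ with $\gamma(A)\in A$ for all $A\in D_p$), there is a term $t(x_1,\dots,x_k)$ built from the variables using only the binary operation $\underline{\phantom{a}}[\underline{\phantom{a}}]$ such that $t(s_1,\dots,s_k)=\gamma$, where $t$ is evaluated in $\mathcal{P}(\wp(S),S)$ with update.
   Context: $\mathcal{P}(X,Y)$ is the set of partial functions from $X$ to $Y$; $\wp(S)$ is the powerset of $S$. Override: $(f\sqcup g)(x)=f(x)$ if $x\in\mathrm{dom}(f)$, $=g(x)$ if $x\in\mathrm{dom}(g)\setminus\mathrm{dom}(f)$, undefined otherwise. Update: $f[g]$ is the restriction of $g\sqcup f$ to $\mathrm{dom}(f)$ (i.e. $f[g](x)=g(x)$ if $x\in\mathrm{dom}(f)\cap\mathrm{dom}(g)$, $f(x)$ if $x\in\mathrm{dom}(f)\setminus\mathrm{dom}(g)$, undefined otherwise). (The functions $s_1,\dots,s_k$ are the canonical representation of the free generators of the free algebra of $\operatorname{Rep}(\{\underline{\phantom{a}}[\underline{\phantom{a}}]\})$.) -}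

module Defs where

open import Data.Nat using (ℕ)
open import Data.Fin using (Fin)
open import Data.Fin.Subset using (Subset; _∈_)
open import Data.Fin.Subset.Properties using (_∈?_)
open import Data.Maybe using (Maybe; just; nothing)
open import Relation.Nullary using (yes; no)

_⇀_ : Set → Set → Set
X ⇀ Y = X → Maybe Y

-- The carrier P(℘(S), S) with S = Fin k (i.e. {1,…,k} shifted to {0,…,k-1}).
PF : ℕ → Set
PF k = Subset k ⇀ Fin k

_[_] : {X Y : Set} → (X ⇀ Y) → (X ⇀ Y) → (X ⇀ Y)
(f [ g ]) x with f x | g x
... | nothing | _      = nothing
... | just a  | nothing = just a
... | just _  | just b  = just b

data Term (k : ℕ) : Set where
  var : Fin k → Term k
  upd : Term k → Term k → Term k

eval : {X Y : Set} {k : ℕ} → Term k → (Fin k → (X ⇀ Y)) → (X ⇀ Y)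
eval (var i)   σ = σ i
eval (upd t u) σ = eval t σ [ eval u σ ]

s : {k : ℕ} → Fin k → PF k
s i A with i ∈? A
... | yes _ = just i
... | no  _ = nothing

module Submission where

-- Two small terms do all the work.  The leaf  x_p[x_c]  is undefined off D_p
-- and, on D_p, takes the value c whenever c ∈ A.  The conditional
-- x_j ? F : G  :=  G[x_j[F]]  agrees with F on sets containing j and with G
-- on the others, provided F and G are defined exactly on D_p.  Given a total
-- g : ℘(S) → S, the decision tree that branches with the conditional on the
-- coordinates 1,…,k in turn and ends in the leaf x_p[x_c] with c = g(A)
-- is undefined off D_p and evaluates on A ∈ D_p to g(A) whenever g(A) ∈ A;
-- for a choice function this holds on all of D_p.  We prove this
-- for a tree querying an arbitrary list of coordinates ι : Fin n → Fin k,
-- which makes the induction on n structural; the theorem is the case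
-- ι = identity with g extending γ.

open import Defs
open import Data.Nat using (ℕ; zero; suc; _≤_)
open import Data.Fin using (Fin; zero; suc)
open import Data.Fin.Subset using (Subset; _∈_; _∉_; inside; outside)
open import Data.Fin.Subset.Properties using (_∈?_)
open import Data.Maybe using (just; nothing)
open import Data.Product using (∃; _×_; _,_)
open import Data.Vec using ([]; _∷_; lookup; tabulate)
open import Data.Vec.Properties using ([]=⇒lookup; lookup⇒[]=; tabulate∘lookup)
open import Data.Vec.Properties.WithK using ([]=-irrelevant)
open import Data.Bool using (Bool; true; false)
open import Function using (id; _∘_)
open import Relation.Nullary using (Dec; yes; no)
open import Data.Empty using (⊥-elim)
open import Relation.Binary.PropositionalEquality
  using (_≡_; refl; cong; sym; trans; module ≡-Reasoning)

[]-undefined : {X Y : Set} (f g : X ⇀ Y) (x : X) →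
               f x ≡ nothing → (f [ g ]) x ≡ nothing
[]-undefined f g x fx rewrite fx = refl

[]-override : {X Y : Set} (f g : X ⇀ Y) (x : X) {a b : Y} →
              f x ≡ just a → g x ≡ just b → (f [ g ]) x ≡ just b
[]-override f g x fx gx rewrite fx | gx = refl

[]-keep : {X Y : Set} (f g : X ⇀ Y) (x : X) {a : Y} →
          f x ≡ just a → g x ≡ nothing → (f [ g ]) x ≡ just a
[]-keep f g x fx gx rewrite fx | gx = refl

s-∈ : {k : ℕ} {i : Fin k} {A : Subset k} → i ∈ A → s i A ≡ just i
s-∈ {i = i} {A} i∈A with i ∈? A
... | yes _   = refl
... | no i∉A = ⊥-elim (i∉A i∈A)

s-∉ : {k : ℕ} {i : Fin k} {A : Subset k} → i ∉ A → s i A ≡ nothing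
s-∉ {i = i} {A} i∉A with i ∈? A
... | yes i∈A = ⊥-elim (i∉A i∈A)
... | no _    = refl

-- The coordinates ι of a subset A, i.e. the subset {m | ι m ∈ A} of Fin n.
-- Definitionally  restrict ι A = lookup A (ι zero) ∷ restrict (ι ∘ suc) A.

restrict : {n k : ℕ} → (Fin n → Fin k) → Subset k → Subset n
restrict ι A = tabulate (lookup A ∘ ι)

restrict-id : {k : ℕ} (A : Subset k) → restrict id A ≡ A
restrict-id = tabulate∘lookup

outside⇒∉ : {k : ℕ} {A : Subset k} {i : Fin k} → lookup A i ≡ outside → i ∉ A
outside⇒∉ bit i∈A with () ← trans (sym ([]=⇒lookup i∈A)) bit

module Construction {k : ℕ} (p : Fin k) where

  -- The value of the leaf x_p[x_c] on a set A ∈ D_p: c if c ∈ A, else p.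
  fallback : Subset k → Fin k → Fin k
  fallback A c with c ∈? A
  ... | yes _ = c
  ... | no  _ = p

  fallback-∈ : {A : Subset k} {c : Fin k} → c ∈ A → fallback A c ≡ c
  fallback-∈ {A} {c} c∈A with c ∈? A
  ... | yes _   = refl
  ... | no c∉A = ⊥-elim (c∉A c∈A)

  fallback-∉ : {A : Subset k} {c : Fin k} → c ∉ A → fallback A c ≡ p
  fallback-∉ {A} {c} c∉A with c ∈? A
  ... | yes c∈A = ⊥-elim (c∉A c∈A)
  ... | no _    = refl

  leaf : Fin k → Term k
  leaf c = upd (var p) (var c)

  leaf-∈ : (c : Fin k) {A : Subset k} → p ∈ A →
           eval (leaf c) s A ≡ just (fallback A c)
  leaf-∈ c {A} p∈A = byMembership (c ∈? A)
    where
    byMembership : Dec (c ∈ A) → eval (leaf c) s A ≡ just (fallback A c)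
    byMembership (yes c∈A) =
      trans ([]-override (s p) (s c) A (s-∈ p∈A) (s-∈ c∈A))
            (cong just (sym (fallback-∈ c∈A)))
    byMembership (no c∉A) =
      trans ([]-keep (s p) (s c) A (s-∈ p∈A) (s-∉ c∉A))
            (cong just (sym (fallback-∉ c∉A)))

  leaf-∉ : (c : Fin k) {A : Subset k} → p ∉ A → eval (leaf c) s A ≡ nothing
  leaf-∉ c {A} p∉A = []-undefined (s p) (s c) A (s-∉ p∉A)

  cond : Fin k → Term k → Term k → Term k
  cond j F G = upd G (upd (var j) F)

  cond-∈ : (j : Fin k) (F G : Term k) {A : Subset k} {a b : Fin k} → j ∈ A →
           eval F s A ≡ just a → eval G s A ≡ just b →
           eval (cond j F G) s A ≡ just a
  cond-∈ j F G {A} j∈A FA GA =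
    []-override (eval G s) (s j [ eval F s ]) A GA
      ([]-override (s j) (eval F s) A (s-∈ j∈A) FA)

  cond-∉ : (j : Fin k) (F G : Term k) {A : Subset k} {b : Fin k} → j ∉ A →
           eval G s A ≡ just b → eval (cond j F G) s A ≡ just b
  cond-∉ j F G {A} j∉A GA =
    []-keep (eval G s) (s j [ eval F s ]) A GA
      ([]-undefined (s j) (eval F s) A (s-∉ j∉A))

  cond-undefined : (j : Fin k) (F G : Term k) {A : Subset k} →
                   eval G s A ≡ nothing → eval (cond j F G) s A ≡ nothing
  cond-undefined j F G {A} GA = []-undefined (eval G s) (s j [ eval F s ]) A GA

  tree    : (n : ℕ) → (Fin n → Fin k) → (Subset n → Fin k) → Term k
  subtree : (n : ℕ) → (Fin (suc n) → Fin k) → (Subset (suc n) → Fin k) → Bool → Term k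
  tree zero    ι g = leaf (g [])
  tree (suc n) ι g = cond (ι zero) (subtree n ι g inside) (subtree n ι g outside)
  subtree n ι g b = tree n (ι ∘ suc) (g ∘ (b ∷_))

  tree-∉ : (n : ℕ) (ι : Fin n → Fin k) (g : Subset n → Fin k) {A : Subset k} →
           p ∉ A → eval (tree n ι g) s A ≡ nothing
  tree-∉ zero    ι g p∉A = leaf-∉ (g []) p∉A
  tree-∉ (suc n) ι g p∉A =
    cond-undefined (ι zero) (subtree n ι g inside) (subtree n ι g outside)
      (tree-∉ n (ι ∘ suc) (g ∘ (outside ∷_)) p∉A)

  tree-∈ : (n : ℕ) (ι : Fin n → Fin k) (g : Subset n → Fin k) {A : Subset k} →
           p ∈ A → eval (tree n ι g) s A ≡ just (fallback A (g (restrict ι A)))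
  tree-∈ zero    ι g p∈A = leaf-∈ (g []) p∈A
  tree-∈ (suc n) ι g {A} p∈A with lookup A (ι zero) in bit
  ... | true  = cond-∈ (ι zero) (subtree n ι g inside) (subtree n ι g outside)
                  (lookup⇒[]= (ι zero) A bit)
                  (tree-∈ n (ι ∘ suc) (g ∘ (inside ∷_)) p∈A)
                  (tree-∈ n (ι ∘ suc) (g ∘ (outside ∷_)) p∈A)
  ... | false = cond-∉ (ι zero) (subtree n ι g inside) (subtree n ι g outside)
                  (outside⇒∉ bit)
                  (tree-∈ n (ι ∘ suc) (g ∘ (outside ∷_)) p∈A)

  extend : ((A : Subset k) → p ∈ A → Fin k) → Subset k → Fin k
  extend γ A with p ∈? A
  ... | yes p∈A = γ A p∈A
  ... | no  _   = p

  -- Membership proofs are unique, so the extension is independent of them.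
  extend-∈ : (γ : (A : Subset k) → p ∈ A → Fin k) {A : Subset k} (p∈A : p ∈ A) →
             extend γ A ≡ γ A p∈A
  extend-∈ γ {A} p∈A with p ∈? A
  ... | yes p∈A′ = cong (γ A) ([]=-irrelevant p∈A′ p∈A)
  ... | no  p∉A  = ⊥-elim (p∉A p∈A)

open Construction

-- The term is the decision tree over all k coordinates for the extension of
-- γ.
theorem6p1 : (k : ℕ) → 1 ≤ k → (p : Fin k)
    → (γ : (A : Subset k) → p ∈ A → Fin k)
    → ((A : Subset k) (h : p ∈ A) → γ A h ∈ A)
    → ∃ λ (t : Term k) →
        ((A : Subset k) (h : p ∈ A) → eval t s A ≡ just (γ A h))
        × ((A : Subset k) → p ∉ A → eval t s A ≡ nothing)
theorem6p1 k _ p γ γ-choice =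
  tree p k id (extend p γ) , realises-γ , (λ A → tree-∉ p k id (extend p γ))
  where
  open ≡-Reasoning

  realises-γ : (A : Subset k) (p∈A : p ∈ A) →
               eval (tree p k id (extend p γ)) s A ≡ just (γ A p∈A)
  realises-γ A p∈A = begin
    eval (tree p k id (extend p γ)) s A
      ≡⟨ tree-∈ p k id (extend p γ) p∈A ⟩
    just (fallback p A (extend p γ (restrict id A)))
      ≡⟨ cong (λ B → just (fallback p A (extend p γ B))) (restrict-id A) ⟩
    just (fallback p A (extend p γ A))
      ≡⟨ cong (just ∘ fallback p A) (extend-∈ p γ p∈A) ⟩
    just (fallback p A (γ A p∈A))
      ≡⟨ cong just (fallback-∈ p (γ-choice A p∈A)) ⟩
    just (γ A p∈A)
      ∎
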